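{- Let $X$ be a vertex parameter that is coverable and summable, let $G$ and $H$ be vertex-disjoint graphs with $g_v\in V(G)$ and $h_v\in V(H)$, and let $G\oplus_v H$ be the graph obtained from $G\sqcup H$ by identifying $g_v$ and $h_v$ into a single vertex $v$. If $X(G\oplus_v H)=X(G-g_v)+X(H-h_v)+1$, then $\mathcal{TS}_X(G-g_v)\,\square\,\mathcal{TS}_X(H-h_v)\cong \mathcal{TS}_X((G\oplus_v H)-v)$, which is isomorphic to a subgraph of $\mathcal{TS}_X(G\oplus_v H)$, and $\mathcal{TE}_X(G-g_v)\,\square\,\mathcal{TE}_X(H-h_v)\cong \mathcal{TE}_X((G\oplus_v H)-v)$, which is isomorphic to a subgraph of $\mathcal{TE}_X(G\oplus_v H)$. Here $\square$ is the Cartesian product.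
   Context: All graphs are finite and simple. A graph parameter $X$ is a vertex parameter defined by property $x$ if either for every graph $G$, $X(G)=\max\{|B|: B\subseteq V(G),\ B \text{ has property } x \text{ in } G\}$, or for every graph $G$, $X(G)=\min\{|B|: B\subseteq V(G),\ B \text{ has property } x \text{ in } G\}$. $X$ is summable if for every graph $G$, $B\subseteq V(G)$ has property $x$ in $G$ iff $B=\bigcup_C B_C$ over the connected components $C$ of $G$ with each $B_C\subseteq V(C)$ having property $x$ in $C$. $X$ is coverable if for every graph $G$ and $v\in V(G)$, whenever $B$ has property $x$ in $G-v$, $B\cup\{v\}$ has property $x$ in $G$. The token exchange graph $\mathcal{TE}_X(G)$ has vertex set $\{S\subseteq V(G): |S|=X(G),\ S\text{ has property } x \text{ in } G\}$, with $S_1S_2$ an edge iff there exist $v_1\in S_1\setminus S_2$, $v_2\in S_2\setminus S_1$ with $S_1\setminus\{v_1\}=S_2\setminus\{v_2\}$. The token sliding graph $\mathcal{TS}_X(G)$ has the same vertex set, with $S_1S_2$ an edge iff such $v_1,v_2$ exist and $v_1v_2\in E(G)$. -}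

module Defs where

open import Data.Nat using (ℕ; zero; suc; _≤_; _+_)
open import Data.Bool using (Bool; true; false; T)
open import Data.Fin using (Fin; zero; suc; punchIn; splitAt)
open import Data.Fin.Subset using (Subset; _∈_; _∉_; ∣_∣; ⁅_⁆; _∪_; _-_; outside; Nonempty)
open import Data.Fin.Permutation using (Permutation′; _⟨$⟩ʳ_; _⟨$⟩ˡ_)
open import Data.Vec using (Vec; []; _∷_; lookup; tabulate; insertAt)
open import Data.Sum using (_⊎_; inj₁; inj₂)
open import Data.Product using (Σ; _×_; _,_; ∃)
open import Relation.Binary.PropositionalEquality using (_≡_; refl)
open import Relation.Nullary using (¬_)

record Graph (n : ℕ) : Set where
  field
    adj    : Fin n → Fin n → Bool
    sym    : ∀ i j → adj i j ≡ adj j i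
    irrefl : ∀ i → adj i i ≡ false
open Graph public

_－_ : ∀ {m} → Graph (suc m) → Fin (suc m) → Graph m
adj    (G － v) i j = adj G (punchIn v i) (punchIn v j)
sym    (G － v) i j = sym G (punchIn v i) (punchIn v j)
irrefl (G － v) i   = irrefl G (punchIn v i)

data Walk {n} (G : Graph n) : Fin n → Fin n → Set where
  here : ∀ {u} → Walk G u u
  step : ∀ {u w v} → T (adj G u w) → Walk G w v → Walk G u v

IsComponent : ∀ {n} → Graph n → Subset n → Set
IsComponent {n} G C =
  Nonempty C ×
  (∀ u → u ∈ C → ∀ w → (w ∈ C → Walk G u w) × (Walk G u w → w ∈ C))

enum : ∀ {n} (C : Subset n) → Fin ∣ C ∣ → Fin n
enum (true  ∷ C) zero    = zero
enum (true  ∷ C) (suc i) = suc (enum C i)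
enum (false ∷ C) i       = suc (enum C i)

induced : ∀ {n} → Graph n → (C : Subset n) → Graph ∣ C ∣
adj    (induced G C) i j = adj G (enum C i) (enum C j)
sym    (induced G C) i j = sym G (enum C i) (enum C j)
irrefl (induced G C) i   = irrefl G (enum C i)

-- B ∩ V(C), viewed as a subset of V(G[C])
restrict : ∀ {n} (C : Subset n) → Subset n → Subset ∣ C ∣
restrict C B = tabulate (λ i → lookup B (enum C i))

Property : Set
Property = ∀ {n} → Graph n → Subset n → Bool

Parameter : Set
Parameter = ∀ {n} → Graph n → ℕ

image : ∀ {n} → Permutation′ n → Subset n → Subset n
image π B = tabulate (λ j → lookup B (π ⟨$⟩ˡ j))

IsoInvariant : Property → Set
IsoInvariant x = ∀ {n} (G G' : Graph n) (π : Permutation′ n) →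
  (∀ i j → adj G' (π ⟨$⟩ʳ i) (π ⟨$⟩ʳ j) ≡ adj G i j) →
  ∀ B → x G' (image π B) ≡ x G B

IsMaxOf : ∀ {n} → Property → Graph n → ℕ → Set
IsMaxOf {n} x G k =
  (Σ (Subset n) λ B → T (x G B) × ∣ B ∣ ≡ k) × (∀ B → T (x G B) → ∣ B ∣ ≤ k)

IsMinOf : ∀ {n} → Property → Graph n → ℕ → Set
IsMinOf {n} x G k =
  (Σ (Subset n) λ B → T (x G B) × ∣ B ∣ ≡ k) × (∀ B → T (x G B) → k ≤ ∣ B ∣)

DefinedBy : Parameter → Property → Set
DefinedBy X x = (∀ {n} (G : Graph n) → IsMaxOf x G (X G))
              ⊎ (∀ {n} (G : Graph n) → IsMinOf x G (X G))

-- summable: B has x in G iff each B ∩ V(C) has x in C, for every component C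
-- (the decomposition B = ⋃ B_C with B_C ⊆ V(C) forces B_C = B ∩ V(C)).
Summable : Property → Set
Summable x = ∀ {n} (G : Graph n) (B : Subset n) →
  (T (x G B) → ∀ C → IsComponent G C → T (x (induced G C) (restrict C B))) ×
  ((∀ C → IsComponent G C → T (x (induced G C) (restrict C B))) → T (x G B))

liftAt : ∀ {m} → Fin (suc m) → Subset m → Subset (suc m)
liftAt v B = insertAt B v outside

Coverable : Property → Set
Coverable x = ∀ {m} (G : Graph (suc m)) (v : Fin (suc m)) (B : Subset m) →
  T (x (G － v) B) → T (x G (liftAt v B ∪ ⁅ v ⁆))

-- Vertex gluing G ⊕_v H.  Vertex set Fin (suc (a + b)): zero is the
-- identified vertex v, then the vertices of G - g (via splitAt, left part)
-- and of H - h (right part).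

module _ {a b} (G : Graph (suc a)) (g : Fin (suc a)) (H : Graph (suc b)) (h : Fin (suc b)) where
  private
    vA : Fin a ⊎ Fin b → Bool
    vA (inj₁ i) = adj G g (punchIn g i)
    vA (inj₂ j) = adj H h (punchIn h j)

    pA : Fin a ⊎ Fin b → Fin a ⊎ Fin b → Bool
    pA (inj₁ i) (inj₁ j) = adj (G － g) i j
    pA (inj₁ i) (inj₂ j) = false
    pA (inj₂ i) (inj₁ j) = false
    pA (inj₂ i) (inj₂ j) = adj (H － h) i j

    pA-sym : ∀ p q → pA p q ≡ pA q p
    pA-sym (inj₁ i) (inj₁ j) = sym (G － g) i j
    pA-sym (inj₁ i) (inj₂ j) = refl
    pA-sym (inj₂ i) (inj₁ j) = refl
    pA-sym (inj₂ i) (inj₂ j) = sym (H － h) i j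

    pA-irr : ∀ p → pA p p ≡ false
    pA-irr (inj₁ i) = irrefl (G － g) i
    pA-irr (inj₂ i) = irrefl (H － h) i

    gAdj : Fin (suc (a + b)) → Fin (suc (a + b)) → Bool
    gAdj zero    zero    = false
    gAdj zero    (suc j) = vA (splitAt a j)
    gAdj (suc i) zero    = vA (splitAt a i)
    gAdj (suc i) (suc j) = pA (splitAt a i) (splitAt a j)

    gSym : ∀ i j → gAdj i j ≡ gAdj j i
    gSym zero    zero    = refl
    gSym zero    (suc j) = refl
    gSym (suc i) zero    = refl
    gSym (suc i) (suc j) = pA-sym (splitAt a i) (splitAt a j)

    gIrr : ∀ i → gAdj i i ≡ false
    gIrr zero    = refl
    gIrr (suc i) = pA-irr (splitAt a i)

  glue : Graph (suc (a + b))
  adj    glue = gAdj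
  sym    glue = gSym
  irrefl glue = gIrr

glueV : ∀ {a b} → Graph (suc a) → Graph (suc b) → Fin (suc (a + b))
glueV G H = zero

record AGraph : Set₁ where
  field
    V : Set
    E : V → V → Set
open AGraph public

_□_ : AGraph → AGraph → AGraph
V (A □ B) = V A × V B
E (A □ B) (a , b) (a' , b') = (E A a a' × b ≡ b') ⊎ (a ≡ a' × E B b b')

record _≅_ (A B : AGraph) : Set where
  field
    to      : V A → V B
    from    : V B → V A
    from∘to : ∀ u → from (to u) ≡ u
    to∘from : ∀ w → to (from w) ≡ w
    to-E    : ∀ u v → E A u v → E B (to u) (to v)
    to-E⁻   : ∀ u v → E B (to u) (to v) → E A u v

record _↪_ (A B : AGraph) : Set where
  field
    f     : V A → V B
    inj   : ∀ u v → f u ≡ f v → u ≡ v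
    f-E   : ∀ u v → E A u v → E B (f u) (f v)

TokenSet : Parameter → Property → ∀ {n} → Graph n → Set
TokenSet X x {n} G = Σ (Subset n) λ S → ∣ S ∣ ≡ X G × T (x G S)

Exchange : ∀ {n} → Subset n → Subset n → Fin n → Fin n → Set
Exchange S₁ S₂ v₁ v₂ = v₁ ∈ S₁ × v₁ ∉ S₂ × v₂ ∈ S₂ × v₂ ∉ S₁ × (S₁ - v₁ ≡ S₂ - v₂)

TE : Parameter → Property → ∀ {n} → Graph n → AGraph
V (TE X x G) = TokenSet X x G
E (TE X x G) (S₁ , _) (S₂ , _) = ∃ λ v₁ → ∃ λ v₂ → Exchange S₁ S₂ v₁ v₂

TS : Parameter → Property → ∀ {n} → Graph n → AGraph
V (TS X x G) = TokenSet X x G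
E (TS X x G) (S₁ , _) (S₂ , _) =
  ∃ λ v₁ → ∃ λ v₂ → Exchange S₁ S₂ v₁ v₂ × T (adj G v₁ v₂)

-- Deleting v from G ⊕ᵥ H leaves the disjoint union D of L = G − g and R = H − h.
-- The components of D are those of L together with those of R, so by
-- summability (and invariance of x under relabelling) a set p ∪ q with
-- p ⊆ V(L), q ⊆ V(R) has x in D exactly when p has x in L and q has x in R.
-- Hence X(D) = X(L) + X(R), and the optimal sets of D are exactly the unions of
-- optimal sets of L and R.  A token moving between the sides would need an edge
-- between them (sliding) or would change the sizes of the two parts, which are
-- both forced (exchange); so every move happens inside one part, which is the
-- Cartesian product.  Finally, coverability adds v to an optimal set of D, the
-- hypothesis X(G ⊕ᵥ H) = X(D) + 1 makes the result optimal, and adding v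
-- commutes with every token move.
module Submission where

open import Defs hiding (sym)
open import Data.Nat using (ℕ; zero; suc; _+_; _≤_; _≥_; _<_)
open import Data.Nat.Properties
  using (≤-antisym; +-mono-≤; +-monoʳ-≤; +-cancelʳ-≤; +-comm; +-identityʳ; ≡-irrelevant; <-irrefl)
open import Data.Bool using (true; false; T)
open import Data.Bool.Properties using (T-irrelevant)
open import Data.Empty using (⊥-elim)
open import Data.Fin using (Fin; zero; suc; _↑ˡ_; _↑ʳ_; cast)
open import Data.Fin.Properties
  using (cast-is-id; suc-injective; ↑ˡ-injective; ↑ʳ-injective; splitAt-↑ˡ; splitAt-↑ʳ)
open import Data.Fin.Subset using (Subset; _∈_; ∣_∣; _-_; ⊥; outside; Nonempty)
open import Data.Fin.Subset.Properties using (∉⊥; ∣⊥∣≡0; p─⊥≡p; x∈p⇒∣p-x∣<∣p∣; Empty-unique; ∪-identityʳ)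
import Data.Fin.Permutation as Permutation
open import Data.Vec using ([]; _∷_; here; there; lookup; tabulate; _++_; splitAt; tail)
open import Data.Vec.Properties
  using (lookup-++ˡ; lookup-++ʳ; lookup∘tabulate; tabulate∘lookup; tabulate-cong; ++-injectiveˡ; ++-injectiveʳ)
open import Data.Sum using (_⊎_; inj₁; inj₂)
open import Data.Product using (Σ; _×_; _,_; ∃; proj₁; proj₂; uncurry)
open import Function using (_∘_)
open import Relation.Binary.PropositionalEquality
open import Relation.Nullary using (¬_)

∣p++q∣≡∣p∣+∣q∣ : ∀ {m n} (p : Subset m) (q : Subset n) → ∣ p ++ q ∣ ≡ ∣ p ∣ + ∣ q ∣
∣p++q∣≡∣p∣+∣q∣ []          q = refl
∣p++q∣≡∣p∣+∣q∣ (true ∷ p)  q = cong suc (∣p++q∣≡∣p∣+∣q∣ p q)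
∣p++q∣≡∣p∣+∣q∣ (false ∷ p) q = ∣p++q∣≡∣p∣+∣q∣ p q

∣p++⊥∣≡∣p∣ : ∀ {m} n (p : Subset m) → ∣ p ++ ⊥ {n} ∣ ≡ ∣ p ∣
∣p++⊥∣≡∣p∣ n p = trans (∣p++q∣≡∣p∣+∣q∣ p ⊥) (trans (cong (∣ p ∣ +_) (∣⊥∣≡0 n)) (+-identityʳ ∣ p ∣))

∣⊥++q∣≡∣q∣ : ∀ m {n} (q : Subset n) → ∣ ⊥ {m} ++ q ∣ ≡ ∣ q ∣
∣⊥++q∣≡∣q∣ m q = trans (∣p++q∣≡∣p∣+∣q∣ (⊥ {m}) q) (cong (_+ ∣ q ∣) (∣⊥∣≡0 m))

∈-++⁺ˡ : ∀ {m n} {p : Subset m} {q : Subset n} {i} → i ∈ p → i ↑ˡ n ∈ p ++ q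
∈-++⁺ˡ here        = here
∈-++⁺ˡ (there i∈p) = there (∈-++⁺ˡ i∈p)

∈-++⁻ˡ : ∀ {m n} {p : Subset m} {q : Subset n} {i} → i ↑ˡ n ∈ p ++ q → i ∈ p
∈-++⁻ˡ {p = _ ∷ p} {i = zero}  here       = here
∈-++⁻ˡ {p = _ ∷ p} {i = suc i} (there i∈) = there (∈-++⁻ˡ i∈)

∈-++⁺ʳ : ∀ {m n} (p : Subset m) {q : Subset n} {j} → j ∈ q → m ↑ʳ j ∈ p ++ q
∈-++⁺ʳ []      j∈q = j∈q
∈-++⁺ʳ (_ ∷ p) j∈q = there (∈-++⁺ʳ p j∈q)

∈-++⁻ʳ : ∀ {m n} (p : Subset m) {q : Subset n} {j} → m ↑ʳ j ∈ p ++ q → j ∈ q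
∈-++⁻ʳ []      j∈       = j∈
∈-++⁻ʳ (_ ∷ p) (there j∈) = ∈-++⁻ʳ p j∈

++-minusˡ : ∀ {m n} (p : Subset m) (q : Subset n) i → (p ++ q) - (i ↑ˡ n) ≡ (p - i) ++ q
++-minusˡ (_ ∷ p) q zero    = cong (outside ∷_) (trans (p─⊥≡p (p ++ q)) (cong (_++ q) (sym (p─⊥≡p p))))
++-minusˡ (s ∷ p) q (suc i) = cong (s ∷_) (++-minusˡ p q i)

++-minusʳ : ∀ {m n} (p : Subset m) (q : Subset n) j → (p ++ q) - (m ↑ʳ j) ≡ p ++ (q - j)
++-minusʳ []      q j = refl
++-minusʳ (s ∷ p) q j = cong (s ∷_) (++-minusʳ p q j)

↑ˡ≢↑ʳ : ∀ {m n} (i : Fin m) (j : Fin n) → i ↑ˡ n ≢ m ↑ʳ j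
↑ˡ≢↑ʳ zero    j ()
↑ˡ≢↑ʳ (suc i) j eq = ↑ˡ≢↑ʳ i j (suc-injective eq)

data Side (m : ℕ) {n} : Fin (m + n) → Set where
  left  : (i : Fin m) → Side m (i ↑ˡ n)
  right : (j : Fin n) → Side m (m ↑ʳ j)

side : ∀ m {n} (k : Fin (m + n)) → Side m k
side zero    k       = right k
side (suc m) zero    = left zero
side (suc m) (suc k) with side m k
... | left i  = left (suc i)
... | right j = right j

enum-++⊥ : ∀ {m} n (C : Subset m) .(e : ∣ C ∣ ≡ ∣ C ++ ⊥ {n} ∣) (i : Fin ∣ C ∣) →
  enum (C ++ ⊥) (cast e i) ≡ enum C i ↑ˡ n
enum-++⊥ n (true  ∷ C) e zero    = refl
enum-++⊥ n (true  ∷ C) e (suc i) = cong suc (enum-++⊥ n C _ i)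
enum-++⊥ n (false ∷ C) e i       = cong suc (enum-++⊥ n C e i)

enum-⊥++ : ∀ m {n} (C : Subset n) .(e : ∣ C ∣ ≡ ∣ ⊥ {m} ++ C ∣) (i : Fin ∣ C ∣) →
  enum (⊥ {m} ++ C) (cast e i) ≡ m ↑ʳ enum C i
enum-⊥++ zero    C e i = cong (enum C) (cast-is-id e i)
enum-⊥++ (suc m) C e i = cong suc (enum-⊥++ m C e i)

x-cong : ∀ (x : Property) → IsoInvariant x → ∀ {k k'} (e : k ≡ k') {G : Graph k} {G' : Graph k'}
  {B : Subset k} {B' : Subset k'} →
  (∀ i j → adj G' (cast e i) (cast e j) ≡ adj G i j) → (∀ i → lookup B' (cast e i) ≡ lookup B i) →
  x G' B' ≡ x G B
x-cong x iso refl {G} {G'} {B} {B'} adj≡ B≡ = trans (cong (x G') B'≡B) (iso G G' Permutation.id adj'≡ B)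
  where
  castᵢ : ∀ i → cast refl i ≡ i
  castᵢ = cast-is-id refl
  adj'≡ : ∀ i j → adj G' i j ≡ adj G i j
  adj'≡ i j = trans (cong₂ (adj G') (sym (castᵢ i)) (sym (castᵢ j))) (adj≡ i j)
  B'≡B : B' ≡ tabulate (lookup B)
  B'≡B = trans (sym (tabulate∘lookup B'))
               (tabulate-cong (λ i → trans (cong (lookup B') (sym (castᵢ i))) (B≡ i)))

module TokenSetProperties (X : Parameter) (x : Property) {n} {G : Graph n} where

  TokenSet-≡ : {s t : TokenSet X x G} → proj₁ s ≡ proj₁ t → s ≡ t
  TokenSet-≡ {S , c , t} {.S , c' , t'} refl = cong₂ (λ c t → S , c , t) (≡-irrelevant c c') (T-irrelevant t t')

  token-lost-size : (s s' : TokenSet X x G) {u : Fin n} → u ∈ proj₁ s → proj₁ s - u ≢ proj₁ s'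
  token-lost-size (S , c , _) (S' , c' , _) u∈S S-u≡S' =
    <-irrefl (trans c' (sym c)) (subst (λ S′ → ∣ S′ ∣ < ∣ S ∣) S-u≡S' (x∈p⇒∣p-x∣<∣p∣ u∈S))

exchange-++⁺ˡ : ∀ {m n} {p p' : Subset m} {q : Subset n} {u₁ u₂} →
  Exchange p p' u₁ u₂ → Exchange (p ++ q) (p' ++ q) (u₁ ↑ˡ n) (u₂ ↑ˡ n)
exchange-++⁺ˡ {n = n} {p} {p'} {q} {u₁} {u₂} (u₁∈p , u₁∉p' , u₂∈p' , u₂∉p , p-u₁≡p'-u₂) =
  ∈-++⁺ˡ u₁∈p , u₁∉p' ∘ ∈-++⁻ˡ , ∈-++⁺ˡ u₂∈p' , u₂∉p ∘ ∈-++⁻ˡ , (begin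
    (p ++ q) - (u₁ ↑ˡ n)   ≡⟨ ++-minusˡ p q u₁ ⟩
    (p - u₁) ++ q          ≡⟨ cong (_++ q) p-u₁≡p'-u₂ ⟩
    (p' - u₂) ++ q         ≡⟨ ++-minusˡ p' q u₂ ⟨
    (p' ++ q) - (u₂ ↑ˡ n)  ∎)
  where open ≡-Reasoning

exchange-++⁺ʳ : ∀ {m n} {p : Subset m} {q q' : Subset n} {u₁ u₂} →
  Exchange q q' u₁ u₂ → Exchange (p ++ q) (p ++ q') (m ↑ʳ u₁) (m ↑ʳ u₂)
exchange-++⁺ʳ {m} {p = p} {q} {q'} {u₁} {u₂} (u₁∈q , u₁∉q' , u₂∈q' , u₂∉q , q-u₁≡q'-u₂) =
  ∈-++⁺ʳ p u₁∈q , u₁∉q' ∘ ∈-++⁻ʳ p , ∈-++⁺ʳ p u₂∈q' , u₂∉q ∘ ∈-++⁻ʳ p , (begin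
    (p ++ q) - (m ↑ʳ u₁)   ≡⟨ ++-minusʳ p q u₁ ⟩
    p ++ (q - u₁)          ≡⟨ cong (p ++_) q-u₁≡q'-u₂ ⟩
    p ++ (q' - u₂)         ≡⟨ ++-minusʳ p q' u₂ ⟨
    (p ++ q') - (m ↑ʳ u₂)  ∎)
  where open ≡-Reasoning

data ExchangeView {m n} (p p' : Subset m) (q q' : Subset n) : Fin (m + n) → Fin (m + n) → Set where
  within-left   : ∀ {u₁ u₂} → Exchange p p' u₁ u₂ → q ≡ q' → ExchangeView p p' q q' (u₁ ↑ˡ n) (u₂ ↑ˡ n)
  within-right  : ∀ {u₁ u₂} → p ≡ p' → Exchange q q' u₁ u₂ → ExchangeView p p' q q' (m ↑ʳ u₁) (m ↑ʳ u₂)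
  left-to-right : ∀ {u₁ u₂} → u₁ ∈ p → p - u₁ ≡ p' → ExchangeView p p' q q' (u₁ ↑ˡ n) (m ↑ʳ u₂)
  right-to-left : ∀ {u₁ u₂} → u₁ ∈ q → q - u₁ ≡ q' → ExchangeView p p' q q' (m ↑ʳ u₁) (u₂ ↑ˡ n)

exchange-++⁻ : ∀ {m n} (p p' : Subset m) (q q' : Subset n) {v₁ v₂} →
  Exchange (p ++ q) (p' ++ q') v₁ v₂ → ExchangeView p p' q q' v₁ v₂
exchange-++⁻ {m} p p' q q' {v₁} {v₂} (v₁∈ , v₁∉ , v₂∈ , v₂∉ , eq) with side m v₁ | side m v₂
... | left u₁ | left u₂ =
  within-left (∈-++⁻ˡ v₁∈ , v₁∉ ∘ ∈-++⁺ˡ , ∈-++⁻ˡ v₂∈ , v₂∉ ∘ ∈-++⁺ˡ , ++-injectiveˡ _ _ halves)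
              (++-injectiveʳ _ _ halves)
  where
  halves : (p - u₁) ++ q ≡ (p' - u₂) ++ q'
  halves = trans (sym (++-minusˡ p q u₁)) (trans eq (++-minusˡ p' q' u₂))
... | right u₁ | right u₂ =
  within-right (++-injectiveˡ _ _ halves)
               (∈-++⁻ʳ p v₁∈ , v₁∉ ∘ ∈-++⁺ʳ p' , ∈-++⁻ʳ p' v₂∈ , v₂∉ ∘ ∈-++⁺ʳ p , ++-injectiveʳ _ _ halves)
  where
  halves : p ++ (q - u₁) ≡ p' ++ (q' - u₂)
  halves = trans (sym (++-minusʳ p q u₁)) (trans eq (++-minusʳ p' q' u₂))
... | left u₁ | right u₂ =
  left-to-right (∈-++⁻ˡ v₁∈)
    (++-injectiveˡ _ _ (trans (sym (++-minusˡ p q u₁)) (trans eq (++-minusʳ p' q' u₂))))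
... | right u₁ | left u₂ =
  right-to-left (∈-++⁻ʳ p v₁∈)
    (++-injectiveʳ _ _ (trans (sym (++-minusʳ p q u₁)) (trans eq (++-minusˡ p' q' u₂))))

exchange-∷ : ∀ {n} {S S' : Subset n} {v₁ v₂} →
  Exchange S S' v₁ v₂ → Exchange (true ∷ S) (true ∷ S') (suc v₁) (suc v₂)
exchange-∷ (v₁∈S , v₁∉S' , v₂∈S' , v₂∉S , S-v₁≡S'-v₂) =
  there v₁∈S , (λ { (there v₁∈) → v₁∉S' v₁∈ }) , there v₂∈S' , (λ { (there v₂∈) → v₂∉S v₂∈ }) ,
  cong (true ∷_) S-v₁≡S'-v₂

Optimises : (ℕ → ℕ → Set) → Parameter → Property → Set
Optimises _≼_ X x = ∀ {n} (G : Graph n) →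
  (Σ (Subset n) λ B → T (x G B) × ∣ B ∣ ≡ X G) × (∀ B → T (x G B) → ∣ B ∣ ≼ X G)

record Extremal (X : Parameter) (x : Property) : Set₁ where
  infix 4 _≼_
  field
    _≼_       : ℕ → ℕ → Set
    ≼-antisym : ∀ {k l} → k ≼ l → l ≼ k → k ≡ l
    +-mono-≼  : ∀ {k l k' l'} → k ≼ k' → l ≼ l' → k + l ≼ k' + l'
    +-split-≼ : ∀ {k l k' l'} → k ≼ k' → l ≼ l' → k + l ≡ k' + l' → k ≡ k'
    optimises : Optimises _≼_ X x

+-split-≤ : ∀ {k l k' l'} → k ≤ k' → l ≤ l' → k + l ≡ k' + l' → k ≡ k'
+-split-≤ {k} {l} {k'} {l'} k≤k' l≤l' e =
  ≤-antisym k≤k' (+-cancelʳ-≤ l' k' k (subst (_≤ k + l') e (+-monoʳ-≤ k l≤l')))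

-- IsMaxOf and IsMinOf are Optimises _≤_ and Optimises _≥_ unfolded.
definedBy⇒extremal : ∀ {X : Parameter} {x : Property} → DefinedBy X x → Extremal X x
definedBy⇒extremal (inj₁ max) = record
  { _≼_ = _≤_ ; ≼-antisym = ≤-antisym ; +-mono-≼ = +-mono-≤ ; +-split-≼ = +-split-≤ ; optimises = max }
definedBy⇒extremal (inj₂ min) = record
  { _≼_ = _≥_ ; ≼-antisym = λ l≤k k≤l → ≤-antisym k≤l l≤k ; +-mono-≼ = +-mono-≤
  ; +-split-≼ = λ k'≤k l'≤l e → sym (+-split-≤ k'≤k l'≤l (sym e)) ; optimises = min }

record IsDisjointUnion {m n} (D : Graph (m + n)) (L : Graph m) (R : Graph n) : Set where
  field
    adj-↑ˡ↑ˡ : ∀ i j → adj D (i ↑ˡ n) (j ↑ˡ n) ≡ adj L i j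
    adj-↑ʳ↑ʳ : ∀ i j → adj D (m ↑ʳ i) (m ↑ʳ j) ≡ adj R i j
    adj-↑ˡ↑ʳ : ∀ i j → adj D (i ↑ˡ n) (m ↑ʳ j) ≡ false

module DisjointUnion {m n} {D : Graph (m + n)} {L : Graph m} {R : Graph n} (D≡L⊎R : IsDisjointUnion D L R) where
  open IsDisjointUnion D≡L⊎R

  adj-↑ʳ↑ˡ : ∀ i j → adj D (m ↑ʳ i) (j ↑ˡ n) ≡ false
  adj-↑ʳ↑ˡ i j = trans (Graph.sym D _ _) (adj-↑ˡ↑ʳ j i)

  walk-↑ˡ : ∀ {i j} → Walk L i j → Walk D (i ↑ˡ n) (j ↑ˡ n)
  walk-↑ˡ here       = here
  walk-↑ˡ (step e w) = step (subst T (sym (adj-↑ˡ↑ˡ _ _)) e) (walk-↑ˡ w)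

  walk-↑ʳ : ∀ {i j} → Walk R i j → Walk D (m ↑ʳ i) (m ↑ʳ j)
  walk-↑ʳ here       = here
  walk-↑ʳ (step e w) = step (subst T (sym (adj-↑ʳ↑ʳ _ _)) e) (walk-↑ʳ w)

  walk-from-↑ˡ : ∀ {i w} → Walk D (i ↑ˡ n) w → ∃ λ j → w ≡ j ↑ˡ n × Walk L i j
  walk-from-↑ˡ here = _ , refl , here
  walk-from-↑ˡ {i} (step {w = k} e w) with side m k
  ... | right j = ⊥-elim (subst T (adj-↑ˡ↑ʳ i j) e)
  ... | left j with walk-from-↑ˡ w
  ...   | l , refl , wl = l , refl , step (subst T (adj-↑ˡ↑ˡ i j) e) wl

  walk-from-↑ʳ : ∀ {i w} → Walk D (m ↑ʳ i) w → ∃ λ j → w ≡ m ↑ʳ j × Walk R i j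
  walk-from-↑ʳ here = _ , refl , here
  walk-from-↑ʳ {i} (step {w = k} e w) with side m k
  ... | left j = ⊥-elim (subst T (adj-↑ʳ↑ˡ i j) e)
  ... | right j with walk-from-↑ʳ w
  ...   | l , refl , wl = l , refl , step (subst T (adj-↑ʳ↑ʳ i j) e) wl

  walk-↑ˡ⁻ : ∀ {i j} → Walk D (i ↑ˡ n) (j ↑ˡ n) → Walk L i j
  walk-↑ˡ⁻ w with walk-from-↑ˡ w
  ... | l , eq , wl = subst (Walk L _) (sym (↑ˡ-injective n _ l eq)) wl

  walk-↑ʳ⁻ : ∀ {i j} → Walk D (m ↑ʳ i) (m ↑ʳ j) → Walk R i j
  walk-↑ʳ⁻ w with walk-from-↑ʳ w
  ... | l , eq , wl = subst (Walk R _) (sym (↑ʳ-injective m _ l eq)) wl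

  no-walk-↑ˡ↑ʳ : ∀ {i j} → ¬ Walk D (i ↑ˡ n) (m ↑ʳ j)
  no-walk-↑ˡ↑ʳ w with walk-from-↑ˡ w
  ... | l , eq , _ = ↑ˡ≢↑ʳ l _ (sym eq)

  no-walk-↑ʳ↑ˡ : ∀ {i j} → ¬ Walk D (m ↑ʳ i) (j ↑ˡ n)
  no-walk-↑ʳ↑ˡ w with walk-from-↑ʳ w
  ... | l , eq , _ = ↑ˡ≢↑ʳ _ l eq

  component-++⊥ : ∀ {C} → IsComponent L C → IsComponent D (C ++ ⊥)
  component-++⊥ {C} ((i , i∈C) , connected) = (i ↑ˡ n , ∈-++⁺ˡ i∈C) , reach
    where
    reach : ∀ u → u ∈ C ++ ⊥ → ∀ w → (w ∈ C ++ ⊥ → Walk D u w) × (Walk D u w → w ∈ C ++ ⊥)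
    reach u u∈ w with side m u | side m w
    ... | right _ | _       = ⊥-elim (∉⊥ (∈-++⁻ʳ C u∈))
    ... | left _  | right _ = (λ w∈ → ⊥-elim (∉⊥ (∈-++⁻ʳ C w∈))) , ⊥-elim ∘ no-walk-↑ˡ↑ʳ
    ... | left i  | left j  with connected i (∈-++⁻ˡ u∈) j
    ...   | to , from = walk-↑ˡ ∘ to ∘ ∈-++⁻ˡ , ∈-++⁺ˡ ∘ from ∘ walk-↑ˡ⁻

  component-⊥++ : ∀ {C} → IsComponent R C → IsComponent D (⊥ ++ C)
  component-⊥++ {C} ((j , j∈C) , connected) = (m ↑ʳ j , ∈-++⁺ʳ ⊥ j∈C) , reach
    where
    reach : ∀ u → u ∈ ⊥ ++ C → ∀ w → (w ∈ ⊥ ++ C → Walk D u w) × (Walk D u w → w ∈ ⊥ ++ C)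
    reach u u∈ w with side m u | side m w
    ... | left _  | _       = ⊥-elim (∉⊥ (∈-++⁻ˡ u∈))
    ... | right _ | left _  = (λ w∈ → ⊥-elim (∉⊥ (∈-++⁻ˡ w∈))) , ⊥-elim ∘ no-walk-↑ʳ↑ˡ
    ... | right i | right j with connected i (∈-++⁻ʳ ⊥ u∈) j
    ...   | to , from = walk-↑ʳ ∘ to ∘ ∈-++⁻ʳ ⊥ , ∈-++⁺ʳ ⊥ ∘ from ∘ walk-↑ʳ⁻

  component-++⊥⁻ : ∀ {C} → IsComponent D (C ++ ⊥) → IsComponent L C
  component-++⊥⁻ {C} ((u , u∈) , connected) = nonempty (side m u) u∈ , reach
    where
    nonempty : ∀ {u} → Side m u → u ∈ C ++ ⊥ → Nonempty C
    nonempty (left i)  u∈ = i , ∈-++⁻ˡ u∈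
    nonempty (right _) u∈ = ⊥-elim (∉⊥ (∈-++⁻ʳ C u∈))
    reach : ∀ i → i ∈ C → ∀ j → (j ∈ C → Walk L i j) × (Walk L i j → j ∈ C)
    reach i i∈ j with connected (i ↑ˡ n) (∈-++⁺ˡ i∈) (j ↑ˡ n)
    ... | to , from = walk-↑ˡ⁻ ∘ to ∘ ∈-++⁺ˡ , ∈-++⁻ˡ ∘ from ∘ walk-↑ˡ

  component-⊥++⁻ : ∀ {C} → IsComponent D (⊥ ++ C) → IsComponent R C
  component-⊥++⁻ {C} ((u , u∈) , connected) = nonempty (side m u) u∈ , reach
    where
    nonempty : ∀ {u} → Side m u → u ∈ ⊥ ++ C → Nonempty C
    nonempty (left _)  u∈ = ⊥-elim (∉⊥ (∈-++⁻ˡ u∈))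
    nonempty (right j) u∈ = j , ∈-++⁻ʳ ⊥ u∈
    reach : ∀ i → i ∈ C → ∀ j → (j ∈ C → Walk R i j) × (Walk R i j → j ∈ C)
    reach i i∈ j with connected (m ↑ʳ i) (∈-++⁺ʳ ⊥ i∈) (m ↑ʳ j)
    ... | to , from = walk-↑ʳ⁻ ∘ to ∘ ∈-++⁺ʳ ⊥ , ∈-++⁻ʳ ⊥ ∘ from ∘ walk-↑ʳ

  component-++ : ∀ {p q} → IsComponent D (p ++ q) → (IsComponent L p × q ≡ ⊥) ⊎ (p ≡ ⊥ × IsComponent R q)
  component-++ {p} {q} comp@((u , u∈) , connected) with side m u
  ... | left _  = inj₁ (component-++⊥⁻ (subst (λ q → IsComponent D (p ++ q)) q≡⊥ comp) , q≡⊥)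
    where
    q≡⊥ : q ≡ ⊥
    q≡⊥ = Empty-unique λ (j , j∈q) → no-walk-↑ˡ↑ʳ (proj₁ (connected _ u∈ _) (∈-++⁺ʳ p j∈q))
  ... | right _ = inj₂ (p≡⊥ , component-⊥++⁻ (subst (λ p → IsComponent D (p ++ q)) p≡⊥ comp))
    where
    p≡⊥ : p ≡ ⊥
    p≡⊥ = Empty-unique λ (i , i∈p) → no-walk-↑ʳ↑ˡ (proj₁ (connected _ u∈ _) (∈-++⁺ˡ i∈p))

  module _ (x : Property) (iso : IsoInvariant x) (summ : Summable x) where

    x-induced-++⊥ : ∀ C (p : Subset m) (q : Subset n) →
      x (induced D (C ++ ⊥)) (restrict (C ++ ⊥) (p ++ q)) ≡ x (induced L C) (restrict C p)
    x-induced-++⊥ C p q = x-cong x iso e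
      (λ i j → trans (cong₂ (adj D) (enum-++⊥ n C e i) (enum-++⊥ n C e j)) (adj-↑ˡ↑ˡ _ _))
      (λ i → begin
        lookup (restrict (C ++ ⊥) (p ++ q)) (cast e i)  ≡⟨ lookup∘tabulate _ (cast e i) ⟩
        lookup (p ++ q) (enum (C ++ ⊥) (cast e i))      ≡⟨ cong (lookup (p ++ q)) (enum-++⊥ n C e i) ⟩
        lookup (p ++ q) (enum C i ↑ˡ n)                 ≡⟨ lookup-++ˡ p q (enum C i) ⟩
        lookup p (enum C i)                             ≡⟨ lookup∘tabulate _ i ⟨
        lookup (restrict C p) i                         ∎)
      where
      open ≡-Reasoning
      e : ∣ C ∣ ≡ ∣ C ++ ⊥ ∣
      e = sym (∣p++⊥∣≡∣p∣ n C)

    x-induced-⊥++ : ∀ C (p : Subset m) (q : Subset n) →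
      x (induced D (⊥ {m} ++ C)) (restrict (⊥ {m} ++ C) (p ++ q)) ≡ x (induced R C) (restrict C q)
    x-induced-⊥++ C p q = x-cong x iso e
      (λ i j → trans (cong₂ (adj D) (enum-⊥++ m C e i) (enum-⊥++ m C e j)) (adj-↑ʳ↑ʳ _ _))
      (λ i → begin
        lookup (restrict (⊥ {m} ++ C) (p ++ q)) (cast e i)  ≡⟨ lookup∘tabulate _ (cast e i) ⟩
        lookup (p ++ q) (enum (⊥ {m} ++ C) (cast e i))      ≡⟨ cong (lookup (p ++ q)) (enum-⊥++ m C e i) ⟩
        lookup (p ++ q) (m ↑ʳ enum C i)                     ≡⟨ lookup-++ʳ p q (enum C i) ⟩
        lookup q (enum C i)                                 ≡⟨ lookup∘tabulate _ i ⟨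
        lookup (restrict C q) i                             ∎)
      where
      open ≡-Reasoning
      e : ∣ C ∣ ≡ ∣ ⊥ {m} ++ C ∣
      e = sym (∣⊥++q∣≡∣q∣ m C)

    x-++⁻ˡ : ∀ {p : Subset m} {q : Subset n} → T (x D (p ++ q)) → T (x L p)
    x-++⁻ˡ {p} {q} xpq = proj₂ (summ L p) λ C comp →
      subst T (x-induced-++⊥ C p q) (proj₁ (summ D (p ++ q)) xpq (C ++ ⊥) (component-++⊥ comp))

    x-++⁻ʳ : ∀ {p : Subset m} {q : Subset n} → T (x D (p ++ q)) → T (x R q)
    x-++⁻ʳ {p} {q} xpq = proj₂ (summ R q) λ C comp →
      subst T (x-induced-⊥++ C p q) (proj₁ (summ D (p ++ q)) xpq (⊥ ++ C) (component-⊥++ comp))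

    x-++⁺ : ∀ {p q} → T (x L p) → T (x R q) → T (x D (p ++ q))
    x-++⁺ {p} {q} xp xq = proj₂ (summ D (p ++ q)) x-on
      where
      x-on : ∀ C → IsComponent D C → T (x (induced D C) (restrict C (p ++ q)))
      x-on C comp with splitAt m C
      ... | C₁ , C₂ , refl with component-++ {C₁} {C₂} comp
      ...   | inj₁ (compL , refl) = subst T (sym (x-induced-++⊥ C₁ p q)) (proj₁ (summ L p) xp C₁ compL)
      ...   | inj₂ (refl , compR) = subst T (sym (x-induced-⊥++ C₂ p q)) (proj₁ (summ R q) xq C₂ compR)

    module _ {X : Parameter} (extremal : Extremal X x) where
      open Extremal extremal
      open TokenSetProperties X x

      size-++-≼ : ∀ {p : Subset m} {q : Subset n} → T (x D (p ++ q)) → ∣ p ∣ ≼ X L × ∣ q ∣ ≼ X R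
      size-++-≼ {p} {q} xpq = proj₂ (optimises L) p (x-++⁻ˡ xpq) , proj₂ (optimises R) q (x-++⁻ʳ xpq)

      X-additive : X D ≡ X L + X R
      X-additive = ≼-antisym XD≼ XL+XR≼
        where
        XD≼ : X D ≼ X L + X R
        XD≼ with optimises D
        ... | (S , xS , ∣S∣) , _ with splitAt m S
        ...   | p , q , refl =
          subst (_≼ X L + X R) (trans (sym (∣p++q∣≡∣p∣+∣q∣ p q)) ∣S∣)
                (uncurry +-mono-≼ (size-++-≼ {p} {q} xS))
        XL+XR≼ : X L + X R ≼ X D
        XL+XR≼ with optimises L | optimises R
        ... | (p , xp , ∣p∣) , _ | (q , xq , ∣q∣) , _ =
          subst (_≼ X D) (trans (∣p++q∣≡∣p∣+∣q∣ p q) (cong₂ _+_ ∣p∣ ∣q∣))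
                (proj₂ (optimises D) (p ++ q) (x-++⁺ xp xq))

      optimal-++⁻ : ∀ {p : Subset m} {q : Subset n} →
        T (x D (p ++ q)) → ∣ p ++ q ∣ ≡ X D → ∣ p ∣ ≡ X L × ∣ q ∣ ≡ X R
      optimal-++⁻ {p} {q} xpq ∣p++q∣ =
        +-split-≼ p≼ q≼ sizes , +-split-≼ q≼ p≼ (trans (+-comm ∣ q ∣ ∣ p ∣) (trans sizes (+-comm (X L) (X R))))
        where
        p≼ : ∣ p ∣ ≼ X L
        p≼ = proj₁ (size-++-≼ {p} {q} xpq)
        q≼ : ∣ q ∣ ≼ X R
        q≼ = proj₂ (size-++-≼ {p} {q} xpq)
        sizes : ∣ p ∣ + ∣ q ∣ ≡ X L + X R
        sizes = trans (sym (∣p++q∣≡∣p∣+∣q∣ p q)) (trans ∣p++q∣ X-additive)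

      join : TokenSet X x L × TokenSet X x R → TokenSet X x D
      join ((p , ∣p∣ , xp) , (q , ∣q∣ , xq)) =
        p ++ q , trans (∣p++q∣≡∣p∣+∣q∣ p q) (trans (cong₂ _+_ ∣p∣ ∣q∣) (sym X-additive)) , x-++⁺ xp xq

      split : TokenSet X x D → TokenSet X x L × TokenSet X x R
      split (S , ∣S∣ , xS) with splitAt m S
      ... | p , q , S≡p++q = (p , proj₁ sizes , x-++⁻ˡ xpq) , (q , proj₂ sizes , x-++⁻ʳ xpq)
        where
        xpq : T (x D (p ++ q))
        xpq = subst (T ∘ x D) S≡p++q xS
        sizes : ∣ p ∣ ≡ X L × ∣ q ∣ ≡ X R
        sizes = optimal-++⁻ {p} {q} xpq (subst (λ S → ∣ S ∣ ≡ X D) S≡p++q ∣S∣)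

      split∘join : ∀ s → split (join s) ≡ s
      split∘join ((p , _) , (q , _)) =
        cong₂ _,_ (TokenSet-≡ (sym (++-injectiveˡ p _ p++q≡))) (TokenSet-≡ (sym (++-injectiveʳ p _ p++q≡)))
        where
        p++q≡ : p ++ q ≡ proj₁ (splitAt m (p ++ q)) ++ proj₁ (proj₂ (splitAt m (p ++ q)))
        p++q≡ = proj₂ (proj₂ (splitAt m (p ++ q)))

      join∘split : ∀ s → join (split s) ≡ s
      join∘split (S , _) = TokenSet-≡ (sym (proj₂ (proj₂ (splitAt m S))))

      TS-disjointUnion : (TS X x L □ TS X x R) ≅ TS X x D
      TS-disjointUnion = record
        { to = join ; from = split ; from∘to = split∘join ; to∘from = join∘split
        ; to-E = slide⁺ ; to-E⁻ = slide⁻ }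
        where
        slide⁺ : ∀ s t → E (TS X x L □ TS X x R) s t → E (TS X x D) (join s) (join t)
        slide⁺ _ _ (inj₁ ((u₁ , u₂ , ex , u₁~u₂) , refl)) =
          u₁ ↑ˡ n , u₂ ↑ˡ n , exchange-++⁺ˡ ex , subst T (sym (adj-↑ˡ↑ˡ u₁ u₂)) u₁~u₂
        slide⁺ _ _ (inj₂ (refl , (u₁ , u₂ , ex , u₁~u₂))) =
          m ↑ʳ u₁ , m ↑ʳ u₂ , exchange-++⁺ʳ ex , subst T (sym (adj-↑ʳ↑ʳ u₁ u₂)) u₁~u₂
        slide⁻ : ∀ s t → E (TS X x D) (join s) (join t) → E (TS X x L □ TS X x R) s t
        slide⁻ (s₁ , s₂) (t₁ , t₂) (_ , _ , ex , v₁~v₂)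
          with exchange-++⁻ (proj₁ s₁) (proj₁ t₁) (proj₁ s₂) (proj₁ t₂) ex
        ... | within-left ex' s₂≡t₂  = inj₁ ((_ , _ , ex' , subst T (adj-↑ˡ↑ˡ _ _) v₁~v₂) , TokenSet-≡ s₂≡t₂)
        ... | within-right s₁≡t₁ ex' = inj₂ (TokenSet-≡ s₁≡t₁ , (_ , _ , ex' , subst T (adj-↑ʳ↑ʳ _ _) v₁~v₂))
        ... | left-to-right _ _      = ⊥-elim (subst T (adj-↑ˡ↑ʳ _ _) v₁~v₂)
        ... | right-to-left _ _      = ⊥-elim (subst T (adj-↑ʳ↑ˡ _ _) v₁~v₂)

      TE-disjointUnion : (TE X x L □ TE X x R) ≅ TE X x D
      TE-disjointUnion = record
        { to = join ; from = split ; from∘to = split∘join ; to∘from = join∘split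
        ; to-E = exchange⁺ ; to-E⁻ = exchange⁻ }
        where
        exchange⁺ : ∀ s t → E (TE X x L □ TE X x R) s t → E (TE X x D) (join s) (join t)
        exchange⁺ _ _ (inj₁ ((u₁ , u₂ , ex) , refl)) = u₁ ↑ˡ n , u₂ ↑ˡ n , exchange-++⁺ˡ ex
        exchange⁺ _ _ (inj₂ (refl , (u₁ , u₂ , ex))) = m ↑ʳ u₁ , m ↑ʳ u₂ , exchange-++⁺ʳ ex
        exchange⁻ : ∀ s t → E (TE X x D) (join s) (join t) → E (TE X x L □ TE X x R) s t
        exchange⁻ (s₁ , s₂) (t₁ , t₂) (_ , _ , ex)
          with exchange-++⁻ (proj₁ s₁) (proj₁ t₁) (proj₁ s₂) (proj₁ t₂) ex
        ... | within-left ex' s₂≡t₂  = inj₁ ((_ , _ , ex') , TokenSet-≡ s₂≡t₂)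
        ... | within-right s₁≡t₁ ex' = inj₂ (TokenSet-≡ s₁≡t₁ , (_ , _ , ex'))
        ... | left-to-right u∈ s₁-u≡t₁ = ⊥-elim (token-lost-size s₁ t₁ u∈ s₁-u≡t₁)
        ... | right-to-left u∈ s₂-u≡t₂ = ⊥-elim (token-lost-size s₂ t₂ u∈ s₂-u≡t₂)

module _ (X : Parameter) (x : Property) (cov : Coverable x) {k} (G : Graph (suc k))
         (X-suc : X G ≡ X (G － zero) + 1) where
  open TokenSetProperties X x

  insert-zero : TokenSet X x (G － zero) → TokenSet X x G
  insert-zero (S , ∣S∣ , xS) =
    true ∷ S , trans (cong suc ∣S∣) (sym (trans X-suc (+-comm _ 1))) ,
    subst (T ∘ x G) (cong (true ∷_) (∪-identityʳ S)) (cov G zero S xS)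

  insert-zero-injective : ∀ s t → insert-zero s ≡ insert-zero t → s ≡ t
  insert-zero-injective _ _ = TokenSet-≡ ∘ cong (tail ∘ proj₁)

  TS-delete-zero-↪ : TS X x (G － zero) ↪ TS X x G
  TS-delete-zero-↪ = record
    { f = insert-zero ; inj = insert-zero-injective
    ; f-E = λ { _ _ (v₁ , v₂ , ex , v₁~v₂) → suc v₁ , suc v₂ , exchange-∷ ex , v₁~v₂ } }

  TE-delete-zero-↪ : TE X x (G － zero) ↪ TE X x G
  TE-delete-zero-↪ = record
    { f = insert-zero ; inj = insert-zero-injective
    ; f-E = λ { _ _ (v₁ , v₂ , ex) → suc v₁ , suc v₂ , exchange-∷ ex } }

glue-disjointUnion : ∀ {a b} (G : Graph (suc a)) (g : Fin (suc a)) (H : Graph (suc b)) (h : Fin (suc b)) →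
  IsDisjointUnion (glue G g H h － glueV G H) (G － g) (H － h)
glue-disjointUnion {a} {b} G g H h = record { adj-↑ˡ↑ˡ = ↑ˡ↑ˡ ; adj-↑ʳ↑ʳ = ↑ʳ↑ʳ ; adj-↑ˡ↑ʳ = ↑ˡ↑ʳ }
  where
  D : Graph (a + b)
  D = glue G g H h － glueV G H
  ↑ˡ↑ˡ : ∀ i j → adj D (i ↑ˡ b) (j ↑ˡ b) ≡ adj (G － g) i j
  ↑ˡ↑ˡ i j rewrite splitAt-↑ˡ a i b | splitAt-↑ˡ a j b = refl
  ↑ʳ↑ʳ : ∀ i j → adj D (a ↑ʳ i) (a ↑ʳ j) ≡ adj (H － h) i j
  ↑ʳ↑ʳ i j rewrite splitAt-↑ʳ a b i | splitAt-↑ʳ a b j = refl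
  ↑ˡ↑ʳ : ∀ i j → adj D (i ↑ˡ b) (a ↑ʳ j) ≡ false
  ↑ˡ↑ʳ i j rewrite splitAt-↑ˡ a i b | splitAt-↑ʳ a b j = refl

mainTheorem4 : (X : Parameter) (x : Property) →
    IsoInvariant x → DefinedBy X x → Summable x → Coverable x →
    ∀ {a b} (G : Graph (suc a)) (g : Fin (suc a)) (H : Graph (suc b)) (h : Fin (suc b)) →
    X (glue G g H h) ≡ X (G － g) + X (H － h) + 1 →
    ((TS X x (G － g) □ TS X x (H － h)) ≅ TS X x (glue G g H h － glueV G H)) ×
    (TS X x (glue G g H h － glueV G H) ↪ TS X x (glue G g H h)) ×
    ((TE X x (G － g) □ TE X x (H － h)) ≅ TE X x (glue G g H h － glueV G H)) ×
    (TE X x (glue G g H h － glueV G H) ↪ TE X x (glue G g H h))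
mainTheorem4 X x iso def summ cov G g H h X-glue =
  TS-disjointUnion x iso summ extremal , TS-delete-zero-↪ X x cov (glue G g H h) X-suc ,
  TE-disjointUnion x iso summ extremal , TE-delete-zero-↪ X x cov (glue G g H h) X-suc
  where
  open DisjointUnion (glue-disjointUnion G g H h)
  extremal : Extremal X x
  extremal = definedBy⇒extremal def
  X-suc : X (glue G g H h) ≡ X (glue G g H h － glueV G H) + 1
  X-suc = trans X-glue (cong (_+ 1) (sym (X-additive x iso summ extremal)))
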